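{- Let $\varphi$ be a classical first-order formula, $\mathcal{A}$ an MV-chain, and $\mathbf{M}$ a finite $\mathcal{A}$-model. (1) If $\|\mathrm{PREDEF}_\varphi\|^{\mathcal{A}}_{\mathbf{M},w}>0$ for some evaluation $w$, then $\|\mathrm{PREDEF}_\varphi\|^{\mathcal{A}}_{\mathbf{M},v}>0$ for every evaluation $v$. (2) If $\|\mathrm{PREDEF}_\varphi\|^{\mathcal{A}}_{\mathbf{M},v}>0$ for some evaluation $v$, then for every subformula $\psi$ of $\varphi$, $\|\psi\|^{\mathcal{A}}_{\mathbf{M},v}$ is not a negation fixpoint.
   Context: An MV-chain is a totally ordered MTL-algebra $\langle A,*,\Rightarrow,\sqcap,\sqcup,0,1\rangle$ (bounded lattice, commutative monoid $\langle A,*,1\rangle$, $z*x\le y$ iff $z\le x\Rightarrow y$) satisfying $x\sqcap y=x*(x\Rightarrow y)$ and $\sim\sim x=x$, where $\sim x:=x\Rightarrow 0$ (equivalently, a totally ordered algebra of the variety of Łukasiewicz logic). A negation fixpoint is an element $x$ with $x=\sim x$. First-order formulas are over a countable set of predicate symbols (no constants, functions, equality), with connectives $\&,\to,\land,\bot$, derived $\neg\varphi:=\varphi\to\bot$, $\vee$, $\varphi\leftrightarrow\psi:=(\varphi\to\psi)\land(\psi\to\varphi)$, and quantifiers $\forall,\exists$. A formula is classical if it contains only $\land,\vee,\neg$ as connectives and $\forall$ as its only quantifier. For an atomic formula $P(\vec x)$, $\mathrm{PREDEF}_P:=(\forall\vec x)\neg(P(\vec x)\leftrightarrow\neg P(\vec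 x))$; $\mathrm{PREDEF}_\varphi$ is the $\land$-conjunction of $\mathrm{PREDEF}_P$ over the atomic formulas $P(\vec x)$ occurring in $\varphi$. A finite $\mathcal{A}$-model is $\langle M,\{r_P\}\rangle$ with $M$ finite nonempty and $r_P:M^k\to A$; values $\|\cdot\|^{\mathcal{A}}_{\mathbf{M},v}$ use the operations of $\mathcal{A}$ ($\vee$ as $\sqcup$), $\forall$ as $\min$, $\exists$ as $\max$. -}

module Defs where

open import Level using (Level; suc; _⊔_)
open import Data.Nat using (ℕ; zero) renaming (suc to sucℕ)
open import Data.Nat using () renaming (_≟_ to _≟ℕ_)
open import Data.Fin using (Fin) renaming (zero to fz; suc to fs)
open import Data.Vec using (Vec; toList) renaming (map to vmap)
open import Data.List using (List; []; _∷_; _++_; foldr)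
open import Data.Product using (_×_; _,_)
open import Data.Sum using (_⊎_)
open import Relation.Binary.PropositionalEquality using (_≡_; _≢_)
open import Relation.Nullary using (yes; no)

-- MV-chains (totally ordered MTL-algebras that are divisible and involutive).
-- Equality of the algebra is propositional equality on the carrier.

record MVChain (ℓ : Level) : Set (Level.suc ℓ) where
  infixl 7 _*_
  infixr 6 _⇒_
  infixl 5 _⊓_ _⊔ₐ_
  infix 4 _≤_
  field
    Carrier : Set ℓ
    _*_ _⇒_ _⊓_ _⊔ₐ_ : Carrier → Carrier → Carrier
    0# 1# : Carrier
  _≤_ : Carrier → Carrier → Set ℓ
  x ≤ y = x ⊓ y ≡ x
  field
    ⊓-comm   : ∀ x y → x ⊓ y ≡ y ⊓ x
    ⊔-comm   : ∀ x y → x ⊔ₐ y ≡ y ⊔ₐ x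
    ⊓-assoc  : ∀ x y z → (x ⊓ y) ⊓ z ≡ x ⊓ (y ⊓ z)
    ⊔-assoc  : ∀ x y z → (x ⊔ₐ y) ⊔ₐ z ≡ x ⊔ₐ (y ⊔ₐ z)
    ⊓-absorbs-⊔ : ∀ x y → x ⊓ (x ⊔ₐ y) ≡ x
    ⊔-absorbs-⊓ : ∀ x y → x ⊔ₐ (x ⊓ y) ≡ x
    0-least    : ∀ x → 0# ≤ x
    1-greatest : ∀ x → x ≤ 1#
    *-comm     : ∀ x y → x * y ≡ y * x
    *-assoc    : ∀ x y z → (x * y) * z ≡ x * (y * z)
    *-identityʳ : ∀ x → x * 1# ≡ x
    residuated₁ : ∀ x y z → z * x ≤ y → z ≤ (x ⇒ y)
    residuated₂ : ∀ x y z → z ≤ (x ⇒ y) → z * x ≤ y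
    prelinear  : ∀ x y → (x ⇒ y) ⊔ₐ (y ⇒ x) ≡ 1#
    total      : ∀ x y → x ≤ y ⊎ y ≤ x
    divisible  : ∀ x y → x ⊓ y ≡ x * (x ⇒ y)
    involutive : ∀ x → (x ⇒ 0#) ⇒ 0# ≡ x

  ∼_ : Carrier → Carrier
  ∼ x = x ⇒ 0#

Var : Set
Var = ℕ

data Fm (ar : ℕ → ℕ) : Set where
  atom : (P : ℕ) → Vec Var (ar P) → Fm ar
  _&_ _⇾_ _∧_ _∨_ : Fm ar → Fm ar → Fm ar
  ⊥f : Fm ar
  ∀f ∃f : Var → Fm ar → Fm ar

module _ {ar : ℕ → ℕ} where

  ¬f : Fm ar → Fm ar
  ¬f φ = φ ⇾ ⊥f

  _⇔f_ : Fm ar → Fm ar → Fm ar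
  φ ⇔f ψ = (φ ⇾ ψ) ∧ (ψ ⇾ φ)

  data Classical : Fm ar → Set where
    c-atom : ∀ P xs → Classical (atom P xs)
    c-∧ : ∀ {φ ψ} → Classical φ → Classical ψ → Classical (φ ∧ ψ)
    c-∨ : ∀ {φ ψ} → Classical φ → Classical ψ → Classical (φ ∨ ψ)
    c-¬ : ∀ {φ} → Classical φ → Classical (¬f φ)
    c-∀ : ∀ {x φ} → Classical φ → Classical (∀f x φ)

  data Sub (ψ : Fm ar) : Fm ar → Set where
    here : Sub ψ ψ
    &ˡ : ∀ {a b} → Sub ψ a → Sub ψ (a & b)
    &ʳ : ∀ {a b} → Sub ψ b → Sub ψ (a & b)
    ⇾ˡ : ∀ {a b} → Sub ψ a → Sub ψ (a ⇾ b)
    ⇾ʳ : ∀ {a b} → Sub ψ b → Sub ψ (a ⇾ b)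
    ∧ˡ : ∀ {a b} → Sub ψ a → Sub ψ (a ∧ b)
    ∧ʳ : ∀ {a b} → Sub ψ b → Sub ψ (a ∧ b)
    ∨ˡ : ∀ {a b} → Sub ψ a → Sub ψ (a ∨ b)
    ∨ʳ : ∀ {a b} → Sub ψ b → Sub ψ (a ∨ b)
    ∀s : ∀ {x a} → Sub ψ a → Sub ψ (∀f x a)
    ∃s : ∀ {x a} → Sub ψ a → Sub ψ (∃f x a)

  atoms : Fm ar → List (Fm ar)
  atoms (atom P xs) = atom P xs ∷ []
  atoms (a & b) = atoms a ++ atoms b
  atoms (a ⇾ b) = atoms a ++ atoms b
  atoms (a ∧ b) = atoms a ++ atoms b
  atoms (a ∨ b) = atoms a ++ atoms b
  atoms ⊥f = []
  atoms (∀f x a) = atoms a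
  atoms (∃f x a) = atoms a

  ∀s-list : List Var → Fm ar → Fm ar
  ∀s-list xs θ = foldr ∀f θ xs

  PREDEF-atom : Fm ar → Fm ar
  PREDEF-atom (atom P xs) = ∀s-list (toList xs) (¬f (atom P xs ⇔f ¬f (atom P xs)))
  PREDEF-atom φ = ⊥f ⇾ ⊥f   -- never used (only applied to atoms)

  -- ∧-conjunction of a list of formulas (empty conjunction = ⊥ → ⊥,
  -- which never arises for classical formulas)
  bigAnd : List (Fm ar) → Fm ar
  bigAnd [] = ⊥f ⇾ ⊥f
  bigAnd (a ∷ []) = a
  bigAnd (a ∷ b ∷ as) = a ∧ bigAnd (b ∷ as)

  PREDEF : Fm ar → Fm ar
  PREDEF φ = bigAnd (Data.List.map PREDEF-atom (atoms φ))

record FinModel {ℓ} (ar : ℕ → ℕ) (A : MVChain ℓ) : Set ℓ where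
  open MVChain A
  field
    size : ℕ                        -- the domain has size + 1 elements
    r    : (P : ℕ) → Vec (Fin (sucℕ size)) (ar P) → Carrier

module Semantics {ℓ} {ar : ℕ → ℕ} (A : MVChain ℓ) (𝐌 : FinModel ar A) where
  open MVChain A
  open FinModel 𝐌

  Dom : Set
  Dom = Fin (sucℕ size)

  Eval : Set
  Eval = Var → Dom

  _[_↦_] : Eval → Var → Dom → Eval
  (v [ x ↦ d ]) y with y ≟ℕ x
  ... | yes _ = d
  ... | no  _ = v y

  minF : ∀ {k} → (Fin (sucℕ k) → Carrier) → Carrier
  minF {zero}   f = f fz
  minF {sucℕ k} f = f fz ⊓ minF (λ i → f (fs i))

  maxF : ∀ {k} → (Fin (sucℕ k) → Carrier) → Carrier
  maxF {zero}   f = f fz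
  maxF {sucℕ k} f = f fz ⊔ₐ maxF (λ i → f (fs i))

  ‖_‖ : Fm ar → Eval → Carrier
  ‖ atom P xs ‖ v = r P (vmap v xs)
  ‖ a & b ‖ v = ‖ a ‖ v * ‖ b ‖ v
  ‖ a ⇾ b ‖ v = ‖ a ‖ v ⇒ ‖ b ‖ v
  ‖ a ∧ b ‖ v = ‖ a ‖ v ⊓ ‖ b ‖ v
  ‖ a ∨ b ‖ v = ‖ a ‖ v ⊔ₐ ‖ b ‖ v
  ‖ ⊥f ‖ v = 0#
  ‖ ∀f x a ‖ v = minF (λ d → ‖ a ‖ (v [ x ↦ d ]))
  ‖ ∃f x a ‖ v = maxF (λ d → ‖ a ‖ (v [ x ↦ d ]))

  Pos : Carrier → Set ℓ
  Pos x = (0# ≤ x) × (x ≢ 0#)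

  NegFixpoint : Carrier → Set ℓ
  NegFixpoint x = x ≡ ∼ x

-- PREDEF_φ is a sentence, so its value does not depend on the evaluation.
-- In an MV-chain ∼(a ⇔ ∼a) vanishes when a is a negation fixpoint, so a positive
-- PREDEF_φ says that no atom of φ ever takes a fixpoint value. Non-fixpoints are
-- closed under ∼, and under ⊓, ⊔ and finite minima because these select one of
-- their arguments in a chain; the only other subformula of a classical formula is
-- the ⊥ inside a negation, whose value 0 is not a fixpoint once 0 ≠ 1.
module Submission where

open import Defs
open import Level using (Level)
open import Data.Nat using (ℕ) renaming (suc to sucℕ; _≟_ to _≟ℕ_)
open import Data.Fin using (Fin) renaming (zero to fz; suc to fs)
open import Data.Vec using (Vec; toList; []; _∷_) renaming (map to vmap)
open import Data.List using (List; []; _∷_; map)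
open import Data.List.Membership.Propositional using (_∈_)
open import Data.List.Relation.Unary.Any using (here; there)
open import Data.List.Relation.Unary.All using (All; []; _∷_)
open import Data.List.Relation.Unary.All.Properties using (++⁻ˡ; ++⁻ʳ; map⁻)
open import Data.Product using (_×_; Σ; _,_)
open import Data.Sum using (_⊎_; inj₁; inj₂)
open import Data.Empty using (⊥-elim)
open import Relation.Nullary using (¬_; yes; no)
open import Relation.Binary.PropositionalEquality
  using (_≡_; _≢_; refl; sym; trans; cong; cong₂; subst; module ≡-Reasoning)

module MVChainProperties {ℓ} (A : MVChain ℓ) where
  open MVChain A

  ≤-antisym : ∀ {x y} → x ≤ y → y ≤ x → x ≡ y
  ≤-antisym {x} {y} x≤y y≤x = trans (sym x≤y) (trans (⊓-comm x y) y≤x)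

  ⊓-idem : ∀ x → x ⊓ x ≡ x
  ⊓-idem x = trans (cong (x ⊓_) (sym (⊔-absorbs-⊓ x x))) (⊓-absorbs-⊔ x (x ⊓ x))

  *-identityˡ : ∀ x → 1# * x ≡ x
  *-identityˡ x = trans (*-comm 1# x) (*-identityʳ x)

  ⇒-refl : ∀ x → x ⇒ x ≡ 1#
  ⇒-refl x = ≤-antisym (1-greatest (x ⇒ x)) (residuated₁ x x 1# 1*x≤x)
    where
    1*x≤x : 1# * x ≤ x
    1*x≤x rewrite *-identityˡ x = ⊓-idem x

  ∼0≡1 : ∼ 0# ≡ 1#
  ∼0≡1 = ⇒-refl 0#

  ∼1≡0 : ∼ 1# ≡ 0#
  ∼1≡0 = subst (λ t → ∼ t ≡ 0#) ∼0≡1 (involutive 0#)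

  ⊓-sel : ∀ x y → (x ⊓ y ≡ x) ⊎ (x ⊓ y ≡ y)
  ⊓-sel x y with total x y
  ... | inj₁ x≤y = inj₁ x≤y
  ... | inj₂ y≤x = inj₂ (trans (⊓-comm x y) y≤x)

  y≤x⇒x⊔y≡x : ∀ {x y} → y ≤ x → x ⊔ₐ y ≡ x
  y≤x⇒x⊔y≡x {x} {y} y≤x = trans (cong (x ⊔ₐ_) (sym (trans (⊓-comm x y) y≤x))) (⊔-absorbs-⊓ x y)

  ⊔-sel : ∀ x y → (x ⊔ₐ y ≡ x) ⊎ (x ⊔ₐ y ≡ y)
  ⊔-sel x y with total x y
  ... | inj₁ x≤y = inj₂ (trans (⊔-comm x y) (y≤x⇒x⊔y≡x x≤y))
  ... | inj₂ y≤x = inj₁ (y≤x⇒x⊔y≡x y≤x)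

  ⊓-preserves : ∀ {p} (P : Carrier → Set p) {x y} → P x → P y → P (x ⊓ y)
  ⊓-preserves P {x} {y} px py with ⊓-sel x y
  ... | inj₁ e = subst P (sym e) px
  ... | inj₂ e = subst P (sym e) py

  ⊔-preserves : ∀ {p} (P : Carrier → Set p) {x y} → P x → P y → P (x ⊔ₐ y)
  ⊔-preserves P {x} {y} px py with ⊔-sel x y
  ... | inj₁ e = subst P (sym e) px
  ... | inj₂ e = subst P (sym e) py

  ⊓≢0⇒≢0ˡ : ∀ {x y} → x ⊓ y ≢ 0# → x ≢ 0#
  ⊓≢0⇒≢0ˡ {x} {y} x⊓y≢0 x≡0 = x⊓y≢0 (trans (cong (_⊓ y) x≡0) (0-least y))

  ⊓≢0⇒≢0ʳ : ∀ {x y} → x ⊓ y ≢ 0# → y ≢ 0#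
  ⊓≢0⇒≢0ʳ {x} {y} x⊓y≢0 = ⊓≢0⇒≢0ˡ (λ e → x⊓y≢0 (trans (⊓-comm x y) e))

  ≢0⇒1≢0 : ∀ {x} → x ≢ 0# → 1# ≢ 0#
  ≢0⇒1≢0 {x} x≢0 1≡0 = x≢0 (begin
    x        ≡⟨ sym (1-greatest x) ⟩
    x ⊓ 1#   ≡⟨ cong (x ⊓_) 1≡0 ⟩
    x ⊓ 0#   ≡⟨ ⊓-comm x 0# ⟩
    0# ⊓ x   ≡⟨ 0-least x ⟩
    0#       ∎)
    where open ≡-Reasoning

  NonFixpoint : Carrier → Set ℓ
  NonFixpoint x = x ≢ ∼ x

  ∼-nonFixpoint : ∀ {x} → NonFixpoint x → NonFixpoint (∼ x)
  ∼-nonFixpoint {x} nf ∼x≡∼∼x = nf (sym (trans ∼x≡∼∼x (involutive x)))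

  0-nonFixpoint : 1# ≢ 0# → NonFixpoint 0#
  0-nonFixpoint 1≢0 0≡∼0 = 1≢0 (sym (trans 0≡∼0 ∼0≡1))

  definedness : Carrier → Carrier
  definedness a = ∼ ((a ⇒ ∼ a) ⊓ (∼ a ⇒ a))

  definedness≢0⇒nonFixpoint : ∀ a → definedness a ≢ 0# → NonFixpoint a
  definedness≢0⇒nonFixpoint a d≢0 a≡∼a = d≢0 (begin
    ∼ ((a ⇒ ∼ a) ⊓ (∼ a ⇒ a))   ≡⟨ cong ∼_ (cong₂ _⊓_ a⇒∼a≡1 ∼a⇒a≡1) ⟩
    ∼ (1# ⊓ 1#)                 ≡⟨ cong ∼_ (⊓-idem 1#) ⟩
    ∼ 1#                        ≡⟨ ∼1≡0 ⟩
    0#                          ∎)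
    where
    open ≡-Reasoning
    a⇒∼a≡1 : a ⇒ ∼ a ≡ 1#
    a⇒∼a≡1 = subst (λ t → a ⇒ t ≡ 1#) a≡∼a (⇒-refl a)
    ∼a⇒a≡1 : ∼ a ⇒ a ≡ 1#
    ∼a⇒a≡1 = subst (λ t → t ⇒ a ≡ 1#) a≡∼a (⇒-refl a)

module FormulaProperties {ℓ} {ar : ℕ → ℕ} (A : MVChain ℓ) (𝐌 : FinModel ar A) where
  open MVChain A
  open FinModel 𝐌
  open Semantics A 𝐌
  open MVChainProperties A

  minF-sel : ∀ {k} (f : Fin (sucℕ k) → Carrier) → Σ (Fin (sucℕ k)) (λ i → minF f ≡ f i)
  minF-sel {ℕ.zero} f = fz , refl
  minF-sel {sucℕ k} f with ⊓-sel (f fz) (minF (λ i → f (fs i)))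
  ... | inj₁ e = fz , e
  ... | inj₂ e with minF-sel (λ i → f (fs i))
  ...   | i , e′ = fs i , trans e e′

  minF-preserves : ∀ {p} (P : Carrier → Set p) {k} (f : Fin (sucℕ k) → Carrier) →
                   (∀ i → P (f i)) → P (minF f)
  minF-preserves P f pf with minF-sel f
  ... | i , e = subst P (sym e) (pf i)

  minF-cong : ∀ {k} {f g : Fin (sucℕ k) → Carrier} → (∀ i → f i ≡ g i) → minF f ≡ minF g
  minF-cong {ℕ.zero} f≗g = f≗g fz
  minF-cong {sucℕ k} f≗g = cong₂ _⊓_ (f≗g fz) (minF-cong (λ i → f≗g (fs i)))

  minF≢0⇒≢0 : ∀ {k} (f : Fin (sucℕ k) → Carrier) → minF f ≢ 0# → ∀ i → f i ≢ 0#
  minF≢0⇒≢0 {ℕ.zero} f h fz = h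
  minF≢0⇒≢0 {sucℕ k} f h fz = ⊓≢0⇒≢0ˡ h
  minF≢0⇒≢0 {sucℕ k} f h (fs i) = minF≢0⇒≢0 (λ j → f (fs j)) (⊓≢0⇒≢0ʳ h) i

  update-self : ∀ (v : Eval) x y → (v [ x ↦ v x ]) y ≡ v y
  update-self v x y with y ≟ℕ x
  ... | yes y≡x = cong v (sym y≡x)
  ... | no _ = refl

  update-agrees : ∀ (v w : Eval) x d y {l} → (v y ≡ w y) ⊎ (y ∈ x ∷ l) →
                  ((v [ x ↦ d ]) y ≡ (w [ x ↦ d ]) y) ⊎ (y ∈ l)
  update-agrees v w x d y h with y ≟ℕ x | h
  ... | yes _   | _                  = inj₁ refl
  ... | no _    | inj₁ vy≡wy         = inj₁ vy≡wy
  ... | no y≢x  | inj₂ (here y≡x)    = ⊥-elim (y≢x y≡x)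
  ... | no _    | inj₂ (there y∈l)   = inj₂ y∈l

  DependsOnlyOn : List Var → Fm ar → Set ℓ
  DependsOnlyOn l θ = ∀ v w → (∀ y → y ∈ l → v y ≡ w y) → ‖ θ ‖ v ≡ ‖ θ ‖ w

  Closed : Fm ar → Set ℓ
  Closed θ = ∀ v w → ‖ θ ‖ v ≡ ‖ θ ‖ w

  vmap-cong-∈ : ∀ {n} (xs : Vec Var n) (v w : Eval) →
                (∀ y → y ∈ toList xs → v y ≡ w y) → vmap v xs ≡ vmap w xs
  vmap-cong-∈ [] v w agree = refl
  vmap-cong-∈ (x ∷ xs) v w agree =
    cong₂ _∷_ (agree x (here refl)) (vmap-cong-∈ xs v w (λ y y∈xs → agree y (there y∈xs)))

  atom-dependsOnlyOn : ∀ P xs → DependsOnlyOn (toList xs) (atom P xs)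
  atom-dependsOnlyOn P xs v w agree = cong (r P) (vmap-cong-∈ xs v w agree)

  definedness-dependsOnlyOn : ∀ P xs →
    DependsOnlyOn (toList xs) (¬f (atom P xs ⇔f ¬f (atom P xs)))
  definedness-dependsOnlyOn P xs v w agree = cong definedness (atom-dependsOnlyOn P xs v w agree)

  -- v and w need only agree on l₀ ∖ l, since the quantifiers rebind the variables of l.
  ∀s-list-cong : ∀ {l₀ θ} → DependsOnlyOn l₀ θ → ∀ l v w →
                 (∀ y → y ∈ l₀ → (v y ≡ w y) ⊎ (y ∈ l)) →
                 ‖ ∀s-list l θ ‖ v ≡ ‖ ∀s-list l θ ‖ w
  ∀s-list-cong dep [] v w agree = dep v w λ y y∈l₀ → agreeOn y (agree y y∈l₀)
    where
    agreeOn : ∀ y → (v y ≡ w y) ⊎ (y ∈ []) → v y ≡ w y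
    agreeOn y (inj₁ e) = e
  ∀s-list-cong dep (x ∷ l) v w agree = minF-cong λ d →
    ∀s-list-cong dep l (v [ x ↦ d ]) (w [ x ↦ d ])
      (λ y y∈l₀ → update-agrees v w x d y (agree y y∈l₀))

  ∀s-list-closed : ∀ {l θ} → DependsOnlyOn l θ → Closed (∀s-list l θ)
  ∀s-list-closed {l} dep v w = ∀s-list-cong dep l v w (λ _ y∈l → inj₂ y∈l)

  ∀s-list≢0⇒≢0 : ∀ {l₀ θ} → DependsOnlyOn l₀ θ → ∀ l v → ‖ ∀s-list l θ ‖ v ≢ 0# → ‖ θ ‖ v ≢ 0#
  ∀s-list≢0⇒≢0 dep [] v h = h
  ∀s-list≢0⇒≢0 dep (x ∷ l) v h = ∀s-list≢0⇒≢0 dep l v λ e →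
    minF≢0⇒≢0 _ h (v x)
      (trans (∀s-list-cong dep l (v [ x ↦ v x ]) v (λ y _ → inj₁ (update-self v x y))) e)

  PREDEF-atom-closed : ∀ a → Closed (PREDEF-atom a)
  PREDEF-atom-closed (atom P xs) = ∀s-list-closed (definedness-dependsOnlyOn P xs)
  PREDEF-atom-closed (_ & _)     v w = refl
  PREDEF-atom-closed (_ ⇾ _)     v w = refl
  PREDEF-atom-closed (_ ∧ _)     v w = refl
  PREDEF-atom-closed (_ ∨ _)     v w = refl
  PREDEF-atom-closed ⊥f          v w = refl
  PREDEF-atom-closed (∀f _ _)    v w = refl
  PREDEF-atom-closed (∃f _ _)    v w = refl

  bigAnd-closed : ∀ θs → All Closed θs → Closed (bigAnd θs)
  bigAnd-closed []           []                 v w = refl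
  bigAnd-closed (θ ∷ [])     (cθ ∷ [])          v w = cθ v w
  bigAnd-closed (θ ∷ θ′ ∷ θs) (cθ ∷ cθs)        v w =
    cong₂ _⊓_ (cθ v w) (bigAnd-closed (θ′ ∷ θs) cθs v w)

  PREDEF-closed : ∀ φ → Closed (PREDEF φ)
  PREDEF-closed φ = bigAnd-closed _ (mapClosed (atoms φ))
    where
    mapClosed : ∀ as → All Closed (map PREDEF-atom as)
    mapClosed []       = []
    mapClosed (a ∷ as) = PREDEF-atom-closed a ∷ mapClosed as

  bigAnd≢0⇒All≢0 : ∀ θs v → ‖ bigAnd θs ‖ v ≢ 0# → All (λ θ → ‖ θ ‖ v ≢ 0#) θs
  bigAnd≢0⇒All≢0 []            v h = []
  bigAnd≢0⇒All≢0 (θ ∷ [])      v h = h ∷ []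
  bigAnd≢0⇒All≢0 (θ ∷ θ′ ∷ θs) v h = ⊓≢0⇒≢0ˡ h ∷ bigAnd≢0⇒All≢0 (θ′ ∷ θs) v (⊓≢0⇒≢0ʳ h)

  PredefinedAt : Eval → Fm ar → Set ℓ
  PredefinedAt v a = ‖ PREDEF-atom a ‖ v ≢ 0#

  PREDEF≢0⇒predefined : ∀ φ v → ‖ PREDEF φ ‖ v ≢ 0# → All (PredefinedAt v) (atoms φ)
  PREDEF≢0⇒predefined φ v h = map⁻ (bigAnd≢0⇒All≢0 _ v h)

  predefined⇒nonFixpoint : ∀ P xs v → PredefinedAt v (atom P xs) →
                           ∀ u → NonFixpoint (‖ atom P xs ‖ u)
  predefined⇒nonFixpoint P xs v h u =
    definedness≢0⇒nonFixpoint _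
      (∀s-list≢0⇒≢0 dep (toList xs) u
        (λ e → h (trans (∀s-list-closed dep v u) e)))
    where
    dep = definedness-dependsOnlyOn P xs

  classical-nonFixpoint : ∀ {ψ} v → Classical ψ → All (PredefinedAt v) (atoms ψ) →
                          ∀ u → NonFixpoint (‖ ψ ‖ u)
  classical-nonFixpoint v (c-atom P xs) (h ∷ []) u = predefined⇒nonFixpoint P xs v h u
  classical-nonFixpoint v (c-∧ {a} ca cb) hs u =
    ⊓-preserves NonFixpoint (classical-nonFixpoint v ca (++⁻ˡ (atoms a) hs) u)
                            (classical-nonFixpoint v cb (++⁻ʳ (atoms a) hs) u)
  classical-nonFixpoint v (c-∨ {a} ca cb) hs u =
    ⊔-preserves NonFixpoint (classical-nonFixpoint v ca (++⁻ˡ (atoms a) hs) u)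
                            (classical-nonFixpoint v cb (++⁻ʳ (atoms a) hs) u)
  classical-nonFixpoint v (c-¬ {a} ca) hs u =
    ∼-nonFixpoint (classical-nonFixpoint v ca (++⁻ˡ (atoms a) hs) u)
  classical-nonFixpoint v (c-∀ {x} ca) hs u =
    minF-preserves NonFixpoint _ (λ d → classical-nonFixpoint v ca hs (u [ x ↦ d ]))

  sub-nonFixpoint : ∀ {φ ψ} v → Classical φ → All (PredefinedAt v) (atoms φ) → 1# ≢ 0# →
                    Sub ψ φ → ∀ u → NonFixpoint (‖ ψ ‖ u)
  sub-nonFixpoint v cφ hs 1≢0 here = classical-nonFixpoint v cφ hs
  sub-nonFixpoint v (c-∧ {a} ca cb) hs 1≢0 (∧ˡ s) = sub-nonFixpoint v ca (++⁻ˡ (atoms a) hs) 1≢0 s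
  sub-nonFixpoint v (c-∧ {a} ca cb) hs 1≢0 (∧ʳ s) = sub-nonFixpoint v cb (++⁻ʳ (atoms a) hs) 1≢0 s
  sub-nonFixpoint v (c-∨ {a} ca cb) hs 1≢0 (∨ˡ s) = sub-nonFixpoint v ca (++⁻ˡ (atoms a) hs) 1≢0 s
  sub-nonFixpoint v (c-∨ {a} ca cb) hs 1≢0 (∨ʳ s) = sub-nonFixpoint v cb (++⁻ʳ (atoms a) hs) 1≢0 s
  sub-nonFixpoint v (c-¬ {a} ca) hs 1≢0 (⇾ˡ s) = sub-nonFixpoint v ca (++⁻ˡ (atoms a) hs) 1≢0 s
  sub-nonFixpoint v (c-¬ ca) hs 1≢0 (⇾ʳ here) u = 0-nonFixpoint 1≢0
  sub-nonFixpoint v (c-∀ ca) hs 1≢0 (∀s s) = sub-nonFixpoint v ca hs 1≢0 s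

mainTheorem9 : ∀ {ℓ : Level} (ar : ℕ → ℕ) (A : MVChain ℓ) (𝐌 : FinModel ar A)
    (φ : Fm ar) → Classical φ →
    let open Semantics A 𝐌 in
    (Σ Eval (λ w → Pos (‖ PREDEF φ ‖ w)) → ∀ (v : Eval) → Pos (‖ PREDEF φ ‖ v))
    × (∀ (v : Eval) → Pos (‖ PREDEF φ ‖ v) →
    ∀ (ψ : Fm ar) → Sub ψ φ → ¬ NegFixpoint (‖ ψ ‖ v))
mainTheorem9 ar A 𝐌 φ cφ = evaluationIndependent , noFixpoints
  where
  open Semantics A 𝐌
  open MVChainProperties A using (≢0⇒1≢0)
  open FormulaProperties A 𝐌

  evaluationIndependent : Σ Eval (λ w → Pos (‖ PREDEF φ ‖ w)) → ∀ v → Pos (‖ PREDEF φ ‖ v)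
  evaluationIndependent (w , pos) v = subst Pos (PREDEF-closed φ w v) pos

  noFixpoints : ∀ v → Pos (‖ PREDEF φ ‖ v) → ∀ ψ → Sub ψ φ → ¬ NegFixpoint (‖ ψ ‖ v)
  noFixpoints v (_ , h) ψ s =
    sub-nonFixpoint v cφ (PREDEF≢0⇒predefined φ v h) (≢0⇒1≢0 h) s v
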